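{- Let $\lambda\in X$, $\Lambda=x(\lambda)$, and $\alpha=\epsilon_i-\delta_j$ with $i\in[n]$, $j\in[m]$. (a) If $\lambda\in X_\alpha$ then $\Lambda\in\Pi_\alpha$. (b) If $\lambda\in X_{ -\alpha}$ then $\Lambda\in\Pi_{ -\alpha}$. (c) If $\lambda\in X_{\pm\alpha}$ then $x(t_{\pm\alpha}(\lambda))=\tau_{\pm\alpha}(\Lambda)$.
   Context: Fix positive integers $m>n$. $X$: partitions $\lambda=(\lambda_1\ge\dots\ge\lambda_n\ge0)$ with $\lambda_1\le m$, drawn in the grid with rows $\epsilon_1,\dots,\epsilon_n$ (top to bottom) and columns $\delta_1,\dots,\delta_m$, with $\lambda_k$ left-justified boxes in row $\epsilon_{n+1-k}$; $\lambda'_j=|\{k:\lambda_k\ge j\}|$. $X_\alpha$ (resp. $X_{ -\alpha}$): those $\lambda$ for which box $\epsilon_i-\delta_j$ (row $\epsilon_i$, column $\delta_j$) is an outer corner (resp. inner corner); $t_\alpha$ adds, $t_{ -\alpha}$ removes that box. Elements of $\mathbb Z^{n|m}$ are $(a_1,\dots,a_n|b_1,\dots,b_m)=\sum a_i\epsilon_i-\sum b_j\delta_j$ with $(\Lambda,\epsilon_i-\delta_j)=a_i-b_j$. $x(\lambda)$ has $a_i=m(n-i)+n\lambda_{n+1-i}$, $b_j=n(j-1)+m\lambda'_j$. $\Pi_\alpha=\{\Lambda:(\Lambda,\alpha)=0\}$, $\Pi_{ -\alpha}=\{\Lambda:(\Lambda,\alpha)=n-m\}$, and $\tau_{\pm\alpha}(\Lambda)=\Lambda\pm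 v_\alpha$ with $v_\alpha=n\epsilon_i-m\delta_j$ (adding $n$ to $a_i$ and $m$ to $b_j$). -}

module Defs where

open import Data.Nat as ℕ using (ℕ; suc; _∸_; _≤?_)
open import Data.Integer as ℤ using (ℤ; +_)
open import Data.Fin as Fin using (Fin; toℕ; opposite)
open import Data.Vec using (Vec; lookup; tabulate; updateAt; count)
open import Data.Product using (_×_; _,_)
open import Relation.Binary.PropositionalEquality using (_≡_)

-- A partition λ = (λ₁ ≥ … ≥ λₙ ≥ 0) is stored as a vector whose entry at
-- 0-based index k is λ_{k+1}.
-- λ ∈ X : weakly decreasing and λ₁ ≤ m.
IsPartition : (n m : ℕ) → Vec ℕ n → Set
IsPartition n m λ′ =
  (∀ (k l : Fin n) → k Fin.≤ l → lookup λ′ l ℕ.≤ lookup λ′ k)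
  × (∀ (k : Fin n) → lookup λ′ k ℕ.≤ m)

-- Row ε_i (i 0-based, i.e. ε_{toℕ i + 1}) contains λ_{n+1-i} boxes,
-- which is the entry at index (opposite i) = n - 1 - toℕ i.
rowLen : ∀ {n} → Vec ℕ n → Fin n → ℕ
rowLen λ′ i = lookup λ′ (opposite i)

-- Column δ_j (j 0-based, i.e. δ_{toℕ j + 1}).
-- Box ε_i - δ_j lies in the diagram iff rowLen λ i ≥ toℕ j + 1.

addBox : ∀ {n m} → Vec ℕ n → Fin n → Fin m → Vec ℕ n
addBox λ′ i j = updateAt λ′ (opposite i) suc

removeBox : ∀ {n m} → Vec ℕ n → Fin n → Fin m → Vec ℕ n
removeBox λ′ i j = updateAt λ′ (opposite i) ℕ.pred

-- λ ∈ X_α : box ε_i - δ_j is an outer corner, i.e. it is the box just right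
-- of the end of row ε_i, and adding it yields again an element of X.
OuterCorner : (n m : ℕ) → Vec ℕ n → Fin n → Fin m → Set
OuterCorner n m λ′ i j =
  rowLen λ′ i ≡ toℕ j × IsPartition n m (addBox {n} {m} λ′ i j)

-- λ ∈ X_{-α} : box ε_i - δ_j is an inner corner, i.e. it is the last box of
-- row ε_i, and removing it yields again an element of X.
InnerCorner : (n m : ℕ) → Vec ℕ n → Fin n → Fin m → Set
InnerCorner n m λ′ i j =
  rowLen λ′ i ≡ suc (toℕ j) × IsPartition n m (removeBox {n} {m} λ′ i j)

-- conjugate: λ'_j = #{k : λ_k ≥ j}  (j = toℕ j + 1)
conj : ∀ {n m} → Vec ℕ n → Fin m → ℕ
conj λ′ j = count (λ x → suc (toℕ j) ≤? x) λ′

-- Elements of ℤ^{n|m}: (a₁,…,aₙ | b₁,…,b_m), meaning Σ aᵢεᵢ - Σ b_j δ_j.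
Weight : ℕ → ℕ → Set
Weight n m = Vec ℤ n × Vec ℤ m

-- x(λ): aᵢ = m(n-i) + n λ_{n+1-i},  b_j = n(j-1) + m λ'_j  (1-based i, j).
x : ∀ {n m} → Vec ℕ n → Weight n m
x {n} {m} λ′ =
  ( tabulate (λ i → + (m ℕ.* (n ∸ suc (toℕ i)) ℕ.+ n ℕ.* rowLen λ′ i))
  , tabulate (λ j → + (n ℕ.* toℕ j ℕ.+ m ℕ.* conj λ′ j)) )

-- (Λ, εᵢ - δ_j) = aᵢ - b_j
pair : ∀ {n m} → Weight n m → Fin n → Fin m → ℤ
pair (a , b) i j = lookup a i ℤ.- lookup b j

InΠ+ : ∀ {n m} → Weight n m → Fin n → Fin m → Set
InΠ+ Λ i j = pair Λ i j ≡ + 0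

InΠ- : ∀ {n m} → Weight n m → Fin n → Fin m → Set
InΠ- {n} {m} Λ i j = pair Λ i j ≡ + n ℤ.- + m

-- τ_{±α}(Λ) = Λ ± v_α,  v_α = n εᵢ - m δ_j  (adds n to aᵢ and m to b_j)
τ+ : ∀ {n m} → Weight n m → Fin n → Fin m → Weight n m
τ+ {n} {m} (a , b) i j = (updateAt a i (ℤ._+ + n) , updateAt b j (ℤ._+ + m))

τ- : ∀ {n m} → Weight n m → Fin n → Fin m → Weight n m
τ- {n} {m} (a , b) i j = (updateAt a i (ℤ._- + n) , updateAt b j (ℤ._- + m))

-- Adding the box ε_i − δ_j at an outer corner lengthens row ε_i by one and
-- column δ_j by one and changes no other row or column, so x moves by
-- n ε_i − m δ_j = v_α.  At an outer corner, row ε_i has j − 1 boxes and column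
-- δ_j has n − i boxes (exactly the rows below ε_i), which makes a_i = b_j.
-- An inner corner of λ is the outer corner of λ with that box removed, so (b)
-- and the τ_{−α} half of (c) follow from the outer-corner case.
module Submission where

open import Defs
open import Data.Nat using (ℕ; _<_)
open import Data.Fin using (Fin)
open import Data.Vec using (Vec)
open import Data.Product using (_×_)
open import Relation.Binary.PropositionalEquality using (_≡_)

open import Data.Nat as ℕ using (suc; _≤_; _≤?_; _∸_; z≤n; s≤s)
import Data.Nat.Properties as ℕ
open import Data.Nat.Tactic.RingSolver as ℕ-Solver using ()
open import Data.Integer as ℤ using (ℤ; +_)
import Data.Integer.Properties as ℤ
open import Data.Integer.Tactic.RingSolver as ℤ-Solver using ()
open import Data.Fin as Fin using (zero; suc; toℕ; opposite; _≟_)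
import Data.Fin.Properties as Fin
open import Data.Vec using ([]; _∷_; lookup; tabulate; updateAt; count)
open import Data.Vec.Properties
  using (lookup∘tabulate; lookup∘updateAt; lookup∘updateAt′; updateAt-updateAt-local; updateAt-id)
open import Data.Vec.Relation.Binary.Pointwise.Extensional using (ext; Pointwise-≡⇒≡)
open import Data.Product using (_,_; proj₁; proj₂)
open import Function using (_∘_; _⇔_; mk⇔; Equivalence)
open import Function.Properties.Equivalence using () renaming (refl to ⇔-refl)
open import Relation.Binary.PropositionalEquality
  using (_≢_; refl; sym; trans; cong; cong₂; subst; module ≡-Reasoning)
open import Relation.Nullary using (yes; no; ¬_; contradiction)
open import Relation.Unary using (Pred; Decidable)

module _ {a p} {A : Set a} {P : Pred A p} (P? : Decidable P) where

  count-prefix : ∀ {n} (xs : Vec A n) (c : ℕ) → c ≤ n →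
                 (∀ k → toℕ k < c → P (lookup xs k)) →
                 (∀ k → c ≤ toℕ k → ¬ P (lookup xs k)) →
                 count P? xs ≡ c
  count-prefix []       ℕ.zero    _           _      _       = refl
  count-prefix (x ∷ xs) ℕ.zero    _           _      outside with P? x
  ... | yes px = contradiction px (outside zero z≤n)
  ... | no  _  = count-prefix xs 0 z≤n (λ _ ()) (λ k _ → outside (suc k) z≤n)
  count-prefix (x ∷ xs) (ℕ.suc c) (s≤s c≤n) inside outside with P? x
  ... | yes _   = cong ℕ.suc (count-prefix xs c c≤n (λ k → inside (suc k) ∘ s≤s)
                                                    (λ k → outside (suc k) ∘ s≤s))
  ... | no  ¬px = contradiction (inside zero (s≤s z≤n)) ¬px

  count-cong : ∀ {n} (xs ys : Vec A n) →
               (∀ k → P (lookup xs k) ⇔ P (lookup ys k)) → count P? xs ≡ count P? ys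
  count-cong []       []       _   = refl
  count-cong (x ∷ xs) (y ∷ ys) P⇔ with P? x | P? y
  ... | yes _   | yes _   = cong ℕ.suc (count-cong xs ys (P⇔ ∘ suc))
  ... | no  _   | no  _   = count-cong xs ys (P⇔ ∘ suc)
  ... | yes px  | no  ¬py = contradiction (Equivalence.to   (P⇔ zero) px) ¬py
  ... | no  ¬px | yes py  = contradiction (Equivalence.from (P⇔ zero) py) ¬px

  count-updateAt : ∀ {n} (xs : Vec A n) (i : Fin n) {f : A → A} →
                   P (f (lookup xs i)) ⇔ P (lookup xs i) →
                   count P? (updateAt xs i f) ≡ count P? xs
  count-updateAt xs i {f} P⇔ = count-cong (updateAt xs i f) xs pointwise
    where
    pointwise : ∀ k → P (lookup (updateAt xs i f) k) ⇔ P (lookup xs k)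
    pointwise k with k ≟ i
    ... | yes refl = subst (λ y → P y ⇔ P (lookup xs k)) (sym (lookup∘updateAt k xs)) P⇔
    ... | no  k≢i  = subst (λ y → P y ⇔ P (lookup xs k)) (sym (lookup∘updateAt′ k i k≢i xs)) ⇔-refl

tabulate-updateAt : ∀ {a} {A : Set a} {n} {f g : Fin n → A} (i : Fin n) {h : A → A} →
                    f i ≡ h (g i) → (∀ k → k ≢ i → f k ≡ g k) →
                    tabulate f ≡ updateAt (tabulate g) i h
tabulate-updateAt {f = f} {g} i {h} f≡h∘g f≡g = Pointwise-≡⇒≡ (ext pointwise)
  where
  open ≡-Reasoning
  pointwise : ∀ k → lookup (tabulate f) k ≡ lookup (updateAt (tabulate g) i h) k
  pointwise k with k ≟ i
  ... | yes refl = begin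
    lookup (tabulate f) k              ≡⟨ lookup∘tabulate f k ⟩
    f k                                ≡⟨ f≡h∘g ⟩
    h (g k)                            ≡⟨ cong h (lookup∘tabulate g k) ⟨
    h (lookup (tabulate g) k)          ≡⟨ lookup∘updateAt k (tabulate g) ⟨
    lookup (updateAt (tabulate g) k h) k ∎
  ... | no k≢i = begin
    lookup (tabulate f) k                ≡⟨ lookup∘tabulate f k ⟩
    f k                                  ≡⟨ f≡g k k≢i ⟩
    g k                                  ≡⟨ lookup∘tabulate g k ⟨
    lookup (tabulate g) k                ≡⟨ lookup∘updateAt′ k i k≢i (tabulate g) ⟨
    lookup (updateAt (tabulate g) i h) k ∎

opposite-injective : ∀ {n} {k l : Fin n} → opposite k ≡ opposite l → k ≡ l
opposite-injective {k = k} {l} eq =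
  trans (sym (Fin.opposite-involutive k)) (trans (cong opposite eq) (Fin.opposite-involutive l))

pos-+-*-suc : ∀ a b c → + (a ℕ.+ b ℕ.* suc c) ≡ + (a ℕ.+ b ℕ.* c) ℤ.+ + b
pos-+-*-suc a b c = trans (cong +_ (+-*-suc a b c)) (ℤ.pos-+ (a ℕ.+ b ℕ.* c) b)
  where
  +-*-suc : ∀ a b c → a ℕ.+ b ℕ.* suc c ≡ a ℕ.+ b ℕ.* c ℕ.+ b
  +-*-suc = ℕ-Solver.solve-∀

suc-threshold-⇔ : ∀ {c d} → d ≢ c → (suc d ≤ suc c) ⇔ (suc d ≤ c)
suc-threshold-⇔ d≢c = mk⇔ (λ d<1+c → ℕ.≤∧≢⇒< (ℕ.≤-pred d<1+c) d≢c) ℕ.m≤n⇒m≤1+n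

Decreasing : ∀ {n} → Vec ℕ n → Set
Decreasing {n} v = ∀ (k l : Fin n) → k Fin.≤ l → lookup v l ≤ lookup v k

module BoxAddedAt {n} {v : Vec ℕ n} {p : Fin n} {c : ℕ} (v[p]≡c : lookup v p ≡ c)
                  (v↓ : Decreasing v) (v⁺↓ : Decreasing (updateAt v p suc)) where

  private
    v⁺ = updateAt v p suc

    v⁺[p]≡1+c : lookup v⁺ p ≡ suc c
    v⁺[p]≡1+c = trans (lookup∘updateAt p v) (cong suc v[p]≡c)

    v⁺[k]≡v[k] : ∀ k → k ≢ p → lookup v⁺ k ≡ lookup v k
    v⁺[k]≡v[k] k k≢p = lookup∘updateAt′ k p k≢p v

    v[k]≤c : ∀ k → toℕ p ≤ toℕ k → lookup v k ≤ c
    v[k]≤c k p≤k = subst (lookup v k ≤_) v[p]≡c (v↓ p k p≤k)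

    1+c≤v⁺[k] : ∀ k → toℕ k ≤ toℕ p → suc c ≤ lookup v⁺ k
    1+c≤v⁺[k] k k≤p = subst (_≤ lookup v⁺ k) v⁺[p]≡1+c (v⁺↓ k p k≤p)

  count-above : count (suc c ≤?_) v ≡ toℕ p
  count-above = count-prefix (suc c ≤?_) v (toℕ p) (ℕ.<⇒≤ (Fin.toℕ<n p))
    (λ k k<p → subst (suc c ≤_) (v⁺[k]≡v[k] k (λ { refl → ℕ.<-irrefl refl k<p }))
                                (1+c≤v⁺[k] k (ℕ.<⇒≤ k<p)))
    (λ k p≤k → ℕ.≤⇒≯ (v[k]≤c k p≤k))

  count-above-added : count (suc c ≤?_) v⁺ ≡ suc (toℕ p)
  count-above-added = count-prefix (suc c ≤?_) v⁺ (suc (toℕ p)) (Fin.toℕ<n p)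
    (λ k k≤p → 1+c≤v⁺[k] k (ℕ.≤-pred k≤p))
    (λ k p<k → ℕ.≤⇒≯ (subst (_≤ c) (sym (v⁺[k]≡v[k] k (λ { refl → ℕ.<-irrefl refl p<k })))
                                   (v[k]≤c k (ℕ.<⇒≤ p<k))))

  count-elsewhere : ∀ {d} → d ≢ c → count (suc d ≤?_) v⁺ ≡ count (suc d ≤?_) v
  count-elsewhere d≢c = count-updateAt (suc _ ≤?_) v p
    (subst (λ y → (suc _ ≤ suc y) ⇔ (suc _ ≤ y)) (sym v[p]≡c) (suc-threshold-⇔ d≢c))

rowCoord : ∀ {n} (m : ℕ) → Vec ℕ n → Fin n → ℤ
rowCoord {n} m λ′ i = + (m ℕ.* (n ∸ suc (toℕ i)) ℕ.+ n ℕ.* rowLen λ′ i)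

colCoord : ∀ {n m} → Vec ℕ n → Fin m → ℤ
colCoord {n} {m} λ′ j = + (n ℕ.* toℕ j ℕ.+ m ℕ.* conj λ′ j)

pair-x : ∀ {n m} (λ′ : Vec ℕ n) (i : Fin n) (j : Fin m) →
         pair (x {n} {m} λ′) i j ≡ rowCoord m λ′ i ℤ.- colCoord λ′ j
pair-x {m = m} λ′ i j =
  cong₂ ℤ._-_ (lookup∘tabulate (rowCoord m λ′) i) (lookup∘tabulate (colCoord λ′) j)

rowCoord-addBox : ∀ {n m} (λ′ : Vec ℕ n) (i : Fin n) (j : Fin m) →
                  tabulate (rowCoord m (addBox {n} {m} λ′ i j))
                    ≡ updateAt (tabulate (rowCoord m λ′)) i (ℤ._+ + n)
rowCoord-addBox {n} {m} λ′ i j = tabulate-updateAt i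
  (trans (cong (λ r → + (m ℕ.* (n ∸ suc (toℕ i)) ℕ.+ n ℕ.* r)) (lookup∘updateAt (opposite i) λ′))
         (pos-+-*-suc _ n (rowLen λ′ i)))
  (λ k k≢i → cong (λ r → + (m ℕ.* (n ∸ suc (toℕ k)) ℕ.+ n ℕ.* r))
                  (lookup∘updateAt′ (opposite k) (opposite i) (k≢i ∘ opposite-injective) λ′))

module OuterCornerAt {n m} (λ′ : Vec ℕ n) (i : Fin n) (j : Fin m)
                     (corner : rowLen λ′ i ≡ toℕ j)
                     (λ↓ : Decreasing λ′) (λ⁺↓ : Decreasing (addBox {n} {m} λ′ i j)) where

  open BoxAddedAt {v = λ′} {p = opposite i} corner λ↓ λ⁺↓

  conj-corner : conj λ′ j ≡ n ∸ suc (toℕ i)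
  conj-corner = trans count-above (Fin.opposite-prop i)

  colCoord-addBox : tabulate (colCoord (addBox {n} {m} λ′ i j))
                      ≡ updateAt (tabulate (colCoord λ′)) j (ℤ._+ + m)
  colCoord-addBox = tabulate-updateAt j
    (trans (cong (λ c → + (n ℕ.* toℕ j ℕ.+ m ℕ.* c))
                 (trans count-above-added (cong suc (sym count-above))))
           (pos-+-*-suc _ m (conj λ′ j)))
    (λ k k≢j → cong (λ c → + (n ℕ.* toℕ k ℕ.+ m ℕ.* c))
                    (count-elsewhere (k≢j ∘ Fin.toℕ-injective)))

  x-addBox : x {n} {m} (addBox {n} {m} λ′ i j) ≡ τ+ (x {n} {m} λ′) i j
  x-addBox = cong₂ _,_ (rowCoord-addBox λ′ i j) colCoord-addBox

  pair-x≡0 : pair (x {n} {m} λ′) i j ≡ + 0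
  pair-x≡0 = begin
    pair (x {n} {m} λ′) i j           ≡⟨ pair-x λ′ i j ⟩
    rowCoord m λ′ i ℤ.- colCoord λ′ j ≡⟨ cong₂ (λ r c → + (A ℕ.+ n ℕ.* r) ℤ.- + (B ℕ.+ m ℕ.* c))
                                               corner conj-corner ⟩
    + (A ℕ.+ B) ℤ.- + (B ℕ.+ A)       ≡⟨ cong (λ s → + (A ℕ.+ B) ℤ.- + s) (ℕ.+-comm B A) ⟩
    + (A ℕ.+ B) ℤ.- + (A ℕ.+ B)       ≡⟨ ℤ.+-inverseʳ (+ (A ℕ.+ B)) ⟩
    + 0                               ∎
    where
    open ≡-Reasoning
    A = m ℕ.* (n ∸ suc (toℕ i))
    B = n ℕ.* toℕ j

τ-∘τ+ : ∀ {n m} (Λ : Weight n m) (i : Fin n) (j : Fin m) → τ- (τ+ Λ i j) i j ≡ Λ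
τ-∘τ+ {n} {m} (a , b) i j = cong₂ _,_ (cancel a i (+ n)) (cancel b j (+ m))
  where
  cancel : ∀ {k} (v : Vec ℤ k) (l : Fin k) (s : ℤ) →
           updateAt (updateAt v l (ℤ._+ s)) l (ℤ._- s) ≡ v
  cancel v l s = trans (updateAt-updateAt-local l v (y+s-s≡y (lookup v l) s)) (updateAt-id l v)
    where
    y+s-s≡y : ∀ y s → y ℤ.+ s ℤ.- s ≡ y
    y+s-s≡y = ℤ-Solver.solve-∀

pair-τ+ : ∀ {n m} (Λ : Weight n m) (i : Fin n) (j : Fin m) →
          pair (τ+ Λ i j) i j ≡ pair Λ i j ℤ.+ (+ n ℤ.- + m)
pair-τ+ {n} {m} (a , b) i j =
  trans (cong₂ ℤ._-_ (lookup∘updateAt i a) (lookup∘updateAt j b))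
        (interchange (lookup a i) (lookup b j) (+ n) (+ m))
  where
  interchange : ∀ p q r s → (p ℤ.+ r) ℤ.- (q ℤ.+ s) ≡ (p ℤ.- q) ℤ.+ (r ℤ.- s)
  interchange = ℤ-Solver.solve-∀

module _ {n m : ℕ} (λ′ : Vec ℕ n) (i : Fin n) (j : Fin m)
         (corner : rowLen λ′ i ≡ suc (toℕ j)) where

  addBox-removeBox : addBox {n} {m} (removeBox {n} {m} λ′ i j) i j ≡ λ′
  addBox-removeBox =
    trans (updateAt-updateAt-local (opposite i) λ′
             (trans (cong (ℕ.suc ∘ ℕ.pred) corner) (sym corner)))
          (updateAt-id (opposite i) λ′)

  removeBox-corner : rowLen (removeBox {n} {m} λ′ i j) i ≡ toℕ j
  removeBox-corner = trans (lookup∘updateAt (opposite i) λ′) (cong ℕ.pred corner)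

  innerCorner⇒outerCorner : IsPartition n m λ′ →
                            OuterCorner n m (removeBox {n} {m} λ′ i j) i j
  innerCorner⇒outerCorner λ-partition =
    removeBox-corner , subst (IsPartition n m) (sym addBox-removeBox) λ-partition

module _ {n m : ℕ} (λ′ : Vec ℕ n) (i : Fin n) (j : Fin m)
         (λ-partition : IsPartition n m λ′) where

  outerCorner⇒InΠ+ : OuterCorner n m λ′ i j → InΠ+ (x {n} {m} λ′) i j
  outerCorner⇒InΠ+ (corner , λ⁺↓ , _) =
    OuterCornerAt.pair-x≡0 λ′ i j corner (proj₁ λ-partition) λ⁺↓

  outerCorner⇒x-addBox : OuterCorner n m λ′ i j →
                         x {n} {m} (addBox {n} {m} λ′ i j) ≡ τ+ (x {n} {m} λ′) i j
  outerCorner⇒x-addBox (corner , λ⁺↓ , _) =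
    OuterCornerAt.x-addBox λ′ i j corner (proj₁ λ-partition) λ⁺↓

module _ {n m : ℕ} (λ′ : Vec ℕ n) (i : Fin n) (j : Fin m)
         (λ-partition : IsPartition n m λ′) (inner : InnerCorner n m λ′ i j) where

  private
    μ = removeBox {n} {m} λ′ i j

    μ-outer : OuterCorner n m μ i j
    μ-outer = innerCorner⇒outerCorner λ′ i j (proj₁ inner) λ-partition

  x≡τ+x-removeBox : x {n} {m} λ′ ≡ τ+ (x {n} {m} μ) i j
  x≡τ+x-removeBox = begin
    x λ′                     ≡⟨ cong x (addBox-removeBox λ′ i j (proj₁ inner)) ⟨
    x (addBox {n} {m} μ i j) ≡⟨ outerCorner⇒x-addBox μ i j (proj₂ inner) μ-outer ⟩
    τ+ (x μ) i j             ∎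
    where open ≡-Reasoning

  innerCorner⇒InΠ- : InΠ- (x {n} {m} λ′) i j
  innerCorner⇒InΠ- = begin
    pair (x λ′) i j                      ≡⟨ cong (λ Λ → pair Λ i j) x≡τ+x-removeBox ⟩
    pair (τ+ (x μ) i j) i j              ≡⟨ pair-τ+ (x μ) i j ⟩
    pair (x μ) i j ℤ.+ (+ n ℤ.- + m)     ≡⟨ cong (ℤ._+ (+ n ℤ.- + m))
                                              (outerCorner⇒InΠ+ μ i j (proj₂ inner) μ-outer) ⟩
    + 0 ℤ.+ (+ n ℤ.- + m)                ≡⟨ ℤ.+-identityˡ (+ n ℤ.- + m) ⟩
    + n ℤ.- + m                          ∎
    where open ≡-Reasoning

  innerCorner⇒x-removeBox : x {n} {m} μ ≡ τ- (x {n} {m} λ′) i j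
  innerCorner⇒x-removeBox = begin
    x μ                   ≡⟨ τ-∘τ+ (x μ) i j ⟨
    τ- (τ+ (x μ) i j) i j ≡⟨ cong (λ Λ → τ- Λ i j) x≡τ+x-removeBox ⟨
    τ- (x λ′) i j         ∎
    where open ≡-Reasoning

lemma4p3 : ∀ (n m : ℕ) → 0 < n → n < m →
    (λ′ : Vec ℕ n) → IsPartition n m λ′ →
    (i : Fin n) (j : Fin m) →
    (OuterCorner n m λ′ i j → InΠ+ (x {n} {m} λ′) i j)
    × (InnerCorner n m λ′ i j → InΠ- (x {n} {m} λ′) i j)
    × (OuterCorner n m λ′ i j → x {n} {m} (addBox {n} {m} λ′ i j) ≡ τ+ (x {n} {m} λ′) i j)
    × (InnerCorner n m λ′ i j → x {n} {m} (removeBox {n} {m} λ′ i j) ≡ τ- (x {n} {m} λ′) i j)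
lemma4p3 n m _ _ λ′ λ-partition i j =
    outerCorner⇒InΠ+ λ′ i j λ-partition
  , innerCorner⇒InΠ- λ′ i j λ-partition
  , outerCorner⇒x-addBox λ′ i j λ-partition
  , innerCorner⇒x-removeBox λ′ i j λ-partition
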